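{- For every $n\geq 1$ there is an orientation of the star with center $v_0$ and leaves $v_1,\ldots,v_n$ (a distar $S_n$) that admits a strong SAML with magic constant $\mu=2(n+1)$.
   Context: A distar $S_n$ is the star $K_{1,n}$ with center $v_0$ and leaves $v_1,\ldots,v_n$, with each edge given a direction. For a digraph $G=(V,A)$, a total labeling is a bijection $\lambda:V\cup A\to\{1,2,\ldots,|V|+|A|\}$. For an arc $xy$ (tail $x$, head $y$), $wt^-(xy)=\lambda(xy)+\lambda(y)-\lambda(x)$. An SAML is a total labeling with $wt^-(xy)=\mu$ for all arcs, for some integer $\mu$ (the magic constant). A total labeling is strong if $\lambda(V)=\{1,\ldots,|V|\}$. -}

module Defs where

open import Data.Nat using (ℕ; suc; _+_; _≤_)
open import Data.Integer as ℤ using (ℤ; +_)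
open import Data.Fin using (Fin; zero; suc; toℕ)
open import Data.Sum using (_⊎_; inj₁; inj₂)
open import Data.Bool using (Bool; true; false)
open import Data.Product using (Σ; _×_)
open import Function.Bundles using (_⤖_; Bijection)
open import Relation.Binary.PropositionalEquality using (_≡_)

-- The star K_{1,n}: vertices Fin (suc n), vertex zero is the center v₀,
-- vertex suc i is the leaf v_{i+1}. Edges are indexed by i : Fin n
-- (edge {v₀, v_{i+1}}).
Vertex : ℕ → Set
Vertex n = Fin (suc n)

Edge : ℕ → Set
Edge n = Fin n

-- An orientation of the star (a distar S_n): for each edge,
-- true  means the arc v₀ → v_{i+1}, false means v_{i+1} → v₀.
Orientation : ℕ → Set
Orientation n = Edge n → Bool

tail : ∀ {n} → Orientation n → Edge n → Vertex n
tail o i with o i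
... | true  = zero
... | false = suc i

head : ∀ {n} → Orientation n → Edge n → Vertex n
head o i with o i
... | true  = suc i
... | false = zero

Element : ℕ → Set
Element n = Vertex n ⊎ Edge n

-- A total labeling: a bijection from V ∪ A onto {1,…,|V|+|A|},
-- represented as a bijection onto Fin (|V|+|A|) with label = 1 + index.
TotalLabeling : ℕ → Set
TotalLabeling n = Element n ⤖ Fin (suc n + n)

label : ∀ {n} → TotalLabeling n → Element n → ℕ
label λ' x = suc (toℕ (Bijection.to λ' x))

wt⁻ : ∀ {n} → Orientation n → TotalLabeling n → Edge n → ℤ
wt⁻ o λ' i =
  (+ label λ' (inj₂ i) ℤ.+ + label λ' (inj₁ (head o i))) ℤ.- + label λ' (inj₁ (tail o i))

IsSAML : ∀ {n} → Orientation n → TotalLabeling n → ℤ → Set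
IsSAML o λ' μ = ∀ i → wt⁻ o λ' i ≡ μ

IsStrong : ∀ {n} → TotalLabeling n → Set
IsStrong {n} λ' =
  (∀ v → 1 ≤ label λ' (inj₁ v) × label λ' (inj₁ v) ≤ suc n) ×
  (∀ k → 1 ≤ k → k ≤ suc n → Σ (Vertex n) (λ v → label λ' (inj₁ v) ≡ k))

-- Orient every edge away from the center and label the vertices v₀,…,vₙ by 1,…,n+1
-- and the arc v₀vᵢ by 2n+2−i. Then the weight of v₀vᵢ is (2n+2−i) + (i+1) − 1 = 2n+2.
module Submission where

open import Defs
open import Data.Nat using (ℕ; suc; _+_; _∸_; _*_; _≤_; _≥_; z≤n; s≤s)
open import Data.Nat.Properties using (m+n∸m≡n; m≤m+n; m∸n+n≡m)
open import Data.Nat.Tactic.RingSolver using (solve-∀)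
open import Data.Integer using (+_; _⊖_)
import Data.Integer as ℤ
open import Data.Integer.Properties using ([+m]-[+n]≡m⊖n; ⊖-≥)
open import Data.Fin using (Fin; zero; suc; toℕ; opposite; fromℕ<)
open import Data.Fin.Properties
  using (+↔⊎; toℕ-↑ˡ; toℕ-↑ʳ; opposite-prop; opposite-involutive; toℕ<n; toℕ-fromℕ<)
open import Data.Sum using (inj₁; inj₂)
open import Data.Sum.Function.Propositional using (_⊎-↔_)
open import Data.Bool using (true)
open import Data.Product using (Σ; _×_; _,_)
open import Function.Bundles using (_↔_; mk↔ₛ′)
open import Function.Properties.Inverse using (↔-refl; ↔-sym; ↔-trans; ↔⇒⤖)
open import Relation.Binary.PropositionalEquality using (_≡_; trans; cong; cong₂; subst; module ≡-Reasoning)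

outward : ∀ {n} → Orientation n
outward _ = true

vertexLabel≡suc-toℕ⇒isStrong : ∀ {n} (lab : TotalLabeling n) →
  (∀ v → label lab (inj₁ v) ≡ suc (toℕ v)) → IsStrong lab
vertexLabel≡suc-toℕ⇒isStrong lab vertexLabel = bounded , onto
  where
  bounded : ∀ v → 1 ≤ label lab (inj₁ v) × label lab (inj₁ v) ≤ suc _
  bounded v rewrite vertexLabel v = s≤s z≤n , toℕ<n v
  onto : ∀ k → 1 ≤ k → k ≤ suc _ → Σ (Vertex _) (λ v → label lab (inj₁ v) ≡ k)
  onto (suc k) _ k<n+1 =
    fromℕ< k<n+1 , trans (vertexLabel (fromℕ< k<n+1)) (cong suc (toℕ-fromℕ< k<n+1))

[+m+n]-[+o]≡+p : ∀ m n o p → m + n ≡ o + p → (+ m ℤ.+ + n) ℤ.- + o ≡ + p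
[+m+n]-[+o]≡+p m n o p m+n≡o+p = begin
  + (m + n) ℤ.- + o  ≡⟨ [+m]-[+n]≡m⊖n (m + n) o ⟩
  (m + n) ⊖ o        ≡⟨ cong (_⊖ o) m+n≡o+p ⟩
  (o + p) ⊖ o        ≡⟨ ⊖-≥ (m≤m+n o p) ⟩
  + (o + p ∸ o)      ≡⟨ cong +_ (m+n∸m≡n o p) ⟩
  + p                ∎
  where open ≡-Reasoning

isSAML-outward : ∀ {n} (lab : TotalLabeling n) μ →
  (∀ i → label lab (inj₂ i) + label lab (inj₁ (suc i)) ≡ label lab (inj₁ zero) + μ) →
  IsSAML outward lab (+ μ)
isSAML-outward lab μ balanced i =
  [+m+n]-[+o]≡+p (label lab (inj₂ i)) (label lab (inj₁ (suc i))) (label lab (inj₁ zero)) μ (balanced i)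

opposite↔ : ∀ {n} → Fin n ↔ Fin n
opposite↔ = mk↔ₛ′ opposite opposite opposite-involutive opposite-involutive

verticesThenArcsReversed : ∀ n → TotalLabeling n
verticesThenArcsReversed n = ↔⇒⤖ (↔-trans (↔-refl ⊎-↔ opposite↔) (↔-sym (+↔⊎ {suc n} {n})))

-- Stated with n = k + (j + 1) so that it becomes a semiring identity.
complementary-sum : ∀ k j → suc (suc (k + suc j) + k) + suc (suc j) ≡ 1 + 2 * suc (k + suc j)
complementary-sum = solve-∀

module _ (n : ℕ) where

  private
    lab : TotalLabeling n
    lab = verticesThenArcsReversed n

  vertexLabel : ∀ v → label lab (inj₁ v) ≡ suc (toℕ v)
  vertexLabel v = cong suc (toℕ-↑ˡ v n)

  arcLabel : ∀ i → label lab (inj₂ i) ≡ suc (suc n + (n ∸ suc (toℕ i)))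
  arcLabel i = cong suc (trans (toℕ-↑ʳ (suc n) (opposite i)) (cong (λ k → suc n + k) (opposite-prop i)))

  arcLabel+leafLabel : ∀ i → label lab (inj₂ i) + label lab (inj₁ (suc i)) ≡ 1 + 2 * suc n
  arcLabel+leafLabel i = trans (cong₂ _+_ (arcLabel i) (vertexLabel (suc i))) (
    subst (λ m → suc (suc m + k) + suc (suc j) ≡ 1 + 2 * suc m)
          (m∸n+n≡m (toℕ<n i)) (complementary-sum k j))
    where
    j k : ℕ
    j = toℕ i
    k = n ∸ suc j

mainTheorem7 : (n : ℕ) → n ≥ 1 →
    Σ (Orientation n) (λ o → Σ (TotalLabeling n) (λ lab →
    IsStrong lab × IsSAML o lab (+ (2 * suc n))))
mainTheorem7 n _ =
  outward , lab ,
  vertexLabel≡suc-toℕ⇒isStrong lab (vertexLabel n) ,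
  isSAML-outward lab (2 * suc n) (arcLabel+leafLabel n)
  where
  lab : TotalLabeling n
  lab = verticesThenArcsReversed n
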